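{- Let $k\ge17$ be an integer and let $T$ be a tree with $k$ leaves. Then there exist two finite families $F_1,F_2$ of subtrees of $T$ with the following property: whenever $H_1\subseteq F_1$ and $H_2\subseteq F_2$ are such that either every member of $H_1$ intersects every member of $H_2$, or every member of $H_1$ is disjoint from every member of $H_2$, then $|H_i|\le \frac{2\ln k}{k\ln 2}\,|F_i|$ for some $i\in\{1,2\}$.
   Context: A subtree of a tree $T$ is a connected subgraph of $T$; two subtrees intersect if they share a vertex. Families may contain repeated members (multisets), and sizes count multiplicity. -}

module Defs where

open import Data.Nat using (ℕ; _≤_; suc)
open import Data.Bool using (Bool; true; false)
open import Data.Fin using (Fin)
open import Data.Fin.Subset using (Subset; _∈_; _∉_; Nonempty)
open import Data.List using (List; _∷_; []; length; filter; allFin; last)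
open import Data.List.Relation.Unary.Linked using (Linked)
open import Data.List.Relation.Unary.Unique.Propositional using (Unique)
open import Data.Maybe using (just)
open import Data.Product using (Σ; ∃; _×_)
open import Relation.Nullary using (¬_)
open import Relation.Binary.PropositionalEquality using (_≡_)
open import Data.Nat using (_≟_)

record Graph (n : ℕ) : Set where
  field
    adj     : Fin n → Fin n → Bool
    symm    : ∀ u v → adj u v ≡ adj v u
    irrefl  : ∀ v → adj v v ≡ false

open Graph public

Adj : ∀ {n} → Graph n → Fin n → Fin n → Set
Adj G u v = adj G u v ≡ true

data ReachIn {n} (G : Graph n) (S : Subset n) (u : Fin n) : Fin n → Set where
  here : u ∈ S → ReachIn G S u u
  step : ∀ {w v} → ReachIn G S u w → Adj G w v → v ∈ S → ReachIn G S u v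

ConnectedOn : ∀ {n} → Graph n → Subset n → Set
ConnectedOn G S = Nonempty S × (∀ u v → u ∈ S → v ∈ S → ReachIn G S u v)

allVertices : ∀ n → Subset n
allVertices n = Data.Fin.Subset.⊤

Connected : ∀ {n} → Graph n → Set
Connected {n} G = ConnectedOn G (allVertices n)

IsCycle : ∀ {n} → Graph n → List (Fin n) → Set
IsCycle G [] = Data.Empty.⊥ where import Data.Empty
IsCycle G (x ∷ xs) =
  3 ≤ suc (length xs) × Unique (x ∷ xs) × Linked (Adj G) (x ∷ xs)
  × (∃ λ y → last (x ∷ xs) ≡ just y × Adj G y x)

Acyclic : ∀ {n} → Graph n → Set
Acyclic G = ∀ c → ¬ IsCycle G c

IsTree : ∀ {n} → Graph n → Set
IsTree G = Connected G × Acyclic G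

degree : ∀ {n} → Graph n → Fin n → ℕ
degree {n} G v = length (filter (λ u → Data.Bool.T? (adj G v u)) (allFin n))

numLeaves : ∀ {n} → Graph n → ℕ
numLeaves {n} G = length (filter (λ v → degree G v ≟ 1) (allFin n))

Subtree : ∀ {n} → Graph n → Set
Subtree {n} G = Σ (Subset n) (ConnectedOn G)

Intersect : ∀ {n} → Subset n → Subset n → Set
Intersect {n} A B = ∃ λ (v : Fin n) → v ∈ A × v ∈ B

Disjoint : ∀ {n} → Subset n → Subset n → Set
Disjoint A B = ¬ Intersect A B

-- A finite family (multiset) of subtrees, indexed by Fin m (repetitions allowed).
Family : ∀ {n} → Graph n → ℕ → Set
Family G m = Fin m → Subtree G

-- Fix one leaf x and let ℓ₀, …, ℓ_{k-2} be the other leaves. F₁ consists of the singletons {ℓᵢ};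
-- F₂ has, for every word u ∈ {0,1}^{k-1}, the subtree left after deleting the leaves ℓᵢ with uᵢ = 0
-- (deleting leaves keeps a graph connected, and x survives). If every member of H₂ meets (misses)
-- every member of H₁, then all words indexing H₂ are 1 (0) on the positions of H₁, so
-- |H₂| · 2^|H₁| ≤ 2^(k-1) = |F₂|. Either 2^|H₁| ≤ k, which bounds H₁, or k |H₂| ≤ |F₂|, which bounds H₂.

module Submission where

open import Defs
open import Data.Bool using (Bool; true; false; T?)
open import Data.Bool.Properties using (T-≡; ¬-not)
open import Data.Empty using (⊥-elim)
open import Data.Fin using (Fin; zero; suc; splitAt; _↑ˡ_; _↑ʳ_)
open import Data.Fin.Properties using (splitAt-↑ˡ; splitAt-↑ʳ) renaming (_≟_ to _≟ᶠ_)
open import Data.Fin.Subset using (Subset; _∈_; _∉_; ∣_∣; ⁅_⁆; ⊥; _∪_; ∁; inside; outside)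
open import Data.Fin.Subset.Properties
  using (_∈?_; ∈⊤; ∉⊥; x∈⁅x⁆; x∈⁅y⁆⇒x≡y; x∈p∪q⁺; x∈p∪q⁻; x∉p⇒x∈∁p; x∉∁p⇒x∈p; x∈∁p⇒x∉p;
         ∣p∣≤n; ∣⊥∣≡0; Empty-unique)
open import Data.List as List using (List; []; _∷_; length; allFin)
open import Data.List.Membership.Propositional using () renaming (_∈_ to _∈ₗ_; _∉_ to _∉ₗ_)
open import Data.List.Membership.Propositional.Properties using (∈-filter⁺; ∈-filter⁻; ∈-allFin; ∈-lookup)
open import Data.List.Relation.Unary.All as All using ()
open import Data.List.Relation.Unary.All.Properties using (All¬⇒¬Any)
open import Data.List.Relation.Unary.AllPairs using (_∷_)
open import Data.List.Relation.Unary.Any using (here; there)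
open import Data.List.Relation.Unary.Unique.Propositional using (Unique)
open import Data.List.Relation.Unary.Unique.Propositional.Properties using (allFin⁺; filter⁺)
open import Data.Nat using (ℕ; zero; suc; _+_; _*_; _^_; _≤_; s≤s; z≤n; _≤?_; _≟_)
open import Data.Nat.Properties
open import Data.Product using (Σ; ∃; _×_; _,_; proj₁; proj₂)
open import Data.Sum using (_⊎_; inj₁; inj₂; [_,_]′)
open import Data.Vec as Vec using (Vec; []; _∷_; _++_; lookup; replicate; here; there)
open import Data.Vec.Properties using (lookup-replicate)
open import Function using (_∘_; case_of_; Equivalence)
open import Relation.Nullary using (yes; no; contradiction)
open import Relation.Nullary.Decidable using (decidable-stable)
open import Relation.Binary.PropositionalEquality

Adj-sym : ∀ {n} (G : Graph n) {u v} → Adj G u v → Adj G v u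
Adj-sym G {u} {v} uv = trans (symm G v u) uv

distinct∈⇒2≤length : ∀ {A : Set} {a b : A} {xs : List A} → a ∈ₗ xs → b ∈ₗ xs → a ≢ b → 2 ≤ length xs
distinct∈⇒2≤length (here refl) (here refl) a≢b = ⊥-elim (a≢b refl)
distinct∈⇒2≤length {xs = _ ∷ _ ∷ _} (here refl) (there _) _ = s≤s (s≤s z≤n)
distinct∈⇒2≤length {xs = _ ∷ _ ∷ _} (there _) (here refl) _ = s≤s (s≤s z≤n)
distinct∈⇒2≤length {xs = _ ∷ _ ∷ _} (there a∈) (there b∈) a≢b = m≤n⇒m≤1+n (distinct∈⇒2≤length a∈ b∈ a≢b)

leaf-neighbour-unique : ∀ {n} (G : Graph n) {w a b} → degree G w ≡ 1 → Adj G w a → Adj G w b → a ≡ b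
leaf-neighbour-unique {n} G {w} {a} {b} deg≡1 wa wb = decidable-stable (a ≟ᶠ b) λ a≢b →
  contradiction (subst (2 ≤_) deg≡1 (distinct∈⇒2≤length (neighbour∈ wa) (neighbour∈ wb) a≢b)) λ { (s≤s ()) }
  where
    neighbour∈ : ∀ {v} → Adj G w v → v ∈ₗ List.filter (T? ∘ adj G w) (allFin n)
    neighbour∈ {v} wv = ∈-filter⁺ (T? ∘ adj G w) (∈-allFin v) (Equivalence.from T-≡ wv)

ReachIn-target∈ : ∀ {n} {G : Graph n} {S u v} → ReachIn G S u v → v ∈ S
ReachIn-target∈ (here u∈S) = u∈S
ReachIn-target∈ (step _ _ v∈S) = v∈S

module _ {n} (G : Graph n) (S : Subset n) (leaf-outside : ∀ v → v ∉ S → degree G v ≡ 1) where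

  -- A walk that leaves S steps onto a leaf, and the leaf's only neighbour is where it came from.
  private
    Shadowed : Fin n → Fin n → Set
    Shadowed u v = (v ∈ S → ReachIn G S u v) × (v ∉ S → ∃ λ w → ReachIn G S u w × Adj G w v)

    shadow : ∀ {u v} → u ∈ S → ReachIn G (allVertices n) u v → Shadowed u v
    shadow u∈S (here _) = (λ _ → here u∈S) , (λ u∉S → contradiction u∈S u∉S)
    shadow u∈S (step {w} {v} walk wv _) with shadow u∈S walk | w ∈? S
    ... | in-S , _ | yes w∈S = (λ v∈S → step (in-S w∈S) wv v∈S) , (λ _ → w , in-S w∈S , wv)
    ... | _ , out-S | no w∉S with out-S w∉S
    ...   | y , reach-y , yw = (λ _ → subst (ReachIn G S _) y≡v reach-y) ,
                               (λ v∉S → contradiction (subst (_∈ S) y≡v (ReachIn-target∈ reach-y)) v∉S)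
      where
        y≡v : y ≡ v
        y≡v = leaf-neighbour-unique G (leaf-outside w w∉S) (Adj-sym G yw) wv

  connectedOn-leaf-complement : Connected G → ∀ {s} → s ∈ S → ConnectedOn G S
  connectedOn-leaf-complement (_ , connected) {s} s∈S =
    (s , s∈S) , λ u v u∈S v∈S → proj₁ (shadow u∈S (connected u v ∈⊤ ∈⊤)) v∈S

singletonSubtree : ∀ {n} (G : Graph n) → Fin n → Subtree G
singletonSubtree G v = ⁅ v ⁆ , (v , x∈⁅x⁆ v) , λ u w u∈ w∈ →
  subst₂ (ReachIn G ⁅ v ⁆) (sym (x∈⁅y⁆⇒x≡y v u∈)) (sym (x∈⁅y⁆⇒x≡y v w∈)) (here (x∈⁅x⁆ v))

-- 2 ^ k, unfolded as a sum so that Fin (pow₂ (suc k)) splits with splitAt.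
pow₂ : ℕ → ℕ
pow₂ zero = 1
pow₂ (suc k) = pow₂ k + pow₂ k

1≤pow₂ : ∀ k → 1 ≤ pow₂ k
1≤pow₂ zero = s≤s z≤n
1≤pow₂ (suc k) = ≤-trans (1≤pow₂ k) (m≤m+n (pow₂ k) (pow₂ k))

word : ∀ k → Fin (pow₂ k) → Vec Bool k
word zero _ = []
word (suc k) a = [ (false ∷_) ∘ word k , (true ∷_) ∘ word k ]′ (splitAt (pow₂ k) a)

word-↑ˡ : ∀ k a → word (suc k) (a ↑ˡ pow₂ k) ≡ false ∷ word k a
word-↑ˡ k a = cong [ (false ∷_) ∘ word k , (true ∷_) ∘ word k ]′ (splitAt-↑ˡ (pow₂ k) a (pow₂ k))

word-↑ʳ : ∀ k a → word (suc k) (pow₂ k ↑ʳ a) ≡ true ∷ word k a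
word-↑ʳ k a = cong [ (false ∷_) ∘ word k , (true ∷_) ∘ word k ]′ (splitAt-↑ʳ (pow₂ k) (pow₂ k) a)

∣p++q∣ : ∀ {m m′} (p : Subset m) (q : Subset m′) → ∣ p ++ q ∣ ≡ ∣ p ∣ + ∣ q ∣
∣p++q∣ [] q = refl
∣p++q∣ (inside ∷ p) q = cong suc (∣p++q∣ p q)
∣p++q∣ (outside ∷ p) q = ∣p++q∣ p q

∈-++⁺ˡ : ∀ {m m′} {p : Subset m} {q : Subset m′} {i} → i ∈ p → i ↑ˡ m′ ∈ p ++ q
∈-++⁺ˡ here = here
∈-++⁺ˡ (there i∈p) = there (∈-++⁺ˡ i∈p)

∈-++⁺ʳ : ∀ {m m′} (p : Subset m) {q : Subset m′} {i} → i ∈ q → m ↑ʳ i ∈ p ++ q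
∈-++⁺ʳ [] i∈q = i∈q
∈-++⁺ʳ (_ ∷ p) i∈q = there (∈-++⁺ʳ p i∈q)

memberless⇒∣p∣≡0 : ∀ {m} {p : Subset m} → (∀ i → i ∉ p) → ∣ p ∣ ≡ 0
memberless⇒∣p∣≡0 {m} no-member = trans (cong ∣_∣ (Empty-unique λ (i , i∈p) → no-member i i∈p)) (∣⊥∣≡0 m)

*2^suc-≤-double : ∀ h s p → h * 2 ^ s ≤ p → h * 2 ^ suc s ≤ p + p
*2^suc-≤-double h s p h2^s≤p rewrite +-identityʳ (2 ^ s) | *-distribˡ-+ h (2 ^ s) (2 ^ s) =
  +-mono-≤ h2^s≤p h2^s≤p

AgreeOn : ∀ {k} → Subset k → Vec Bool k → Vec Bool k → Set
AgreeOn I u w = ∀ i → i ∈ I → lookup u i ≡ lookup w i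

AgreeOn-head : ∀ {k} {I : Subset k} {b c u w} → AgreeOn (inside ∷ I) (b ∷ u) (c ∷ w) → b ≡ c
AgreeOn-head agree = agree zero here

AgreeOn-tail : ∀ {k} {I : Subset k} {x b c u w} → AgreeOn (x ∷ I) (b ∷ u) (c ∷ w) → AgreeOn I u w
AgreeOn-tail agree i i∈I = agree (suc i) (there i∈I)

∣agreeing∣*2^∣I∣≤pow₂ : ∀ k (I : Subset k) (w : Vec Bool k) (H : Subset (pow₂ k)) →
                       (∀ a → a ∈ H → AgreeOn I (word k a) w) → ∣ H ∣ * 2 ^ ∣ I ∣ ≤ pow₂ k

∣agreeing-halves∣*2^∣I∣≤pow₂ : ∀ k b c (I : Subset k) (w : Vec Bool k) (xs ys : Subset (pow₂ k)) →
  (∀ a → a ∈ xs → AgreeOn (b ∷ I) (false ∷ word k a) (c ∷ w)) →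
  (∀ a → a ∈ ys → AgreeOn (b ∷ I) (true ∷ word k a) (c ∷ w)) →
  ∣ xs ++ ys ∣ * 2 ^ ∣ b ∷ I ∣ ≤ pow₂ k + pow₂ k

∣agreeing∣*2^∣I∣≤pow₂ zero [] [] H _ = subst (_≤ 1) (sym (*-identityʳ ∣ H ∣)) (∣p∣≤n H)
∣agreeing∣*2^∣I∣≤pow₂ (suc k) (b ∷ I) (c ∷ w) H agree with Vec.splitAt (pow₂ k) H
... | xs , ys , refl = ∣agreeing-halves∣*2^∣I∣≤pow₂ k b c I w xs ys
  (λ a a∈ → subst (λ u → AgreeOn (b ∷ I) u (c ∷ w)) (word-↑ˡ k a) (agree _ (∈-++⁺ˡ a∈)))
  (λ a a∈ → subst (λ u → AgreeOn (b ∷ I) u (c ∷ w)) (word-↑ʳ k a) (agree _ (∈-++⁺ʳ xs a∈)))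

∣agreeing-halves∣*2^∣I∣≤pow₂ k outside c I w xs ys agree-xs agree-ys
  rewrite ∣p++q∣ xs ys | *-distribʳ-+ (2 ^ ∣ I ∣) ∣ xs ∣ ∣ ys ∣ =
  +-mono-≤ (∣agreeing∣*2^∣I∣≤pow₂ k I w xs (λ a → AgreeOn-tail ∘ agree-xs a))
           (∣agreeing∣*2^∣I∣≤pow₂ k I w ys (λ a → AgreeOn-tail ∘ agree-ys a))
∣agreeing-halves∣*2^∣I∣≤pow₂ k inside false I w xs ys agree-xs agree-ys
  rewrite ∣p++q∣ xs ys | memberless⇒∣p∣≡0 (λ a a∈ → case AgreeOn-head (agree-ys a a∈) of λ ()) | +-identityʳ ∣ xs ∣ =
  *2^suc-≤-double ∣ xs ∣ ∣ I ∣ (pow₂ k) (∣agreeing∣*2^∣I∣≤pow₂ k I w xs (λ a → AgreeOn-tail ∘ agree-xs a))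
∣agreeing-halves∣*2^∣I∣≤pow₂ k inside true I w xs ys agree-xs agree-ys
  rewrite ∣p++q∣ xs ys | memberless⇒∣p∣≡0 (λ a a∈ → case AgreeOn-head (agree-xs a a∈) of λ ()) =
  *2^suc-≤-double ∣ ys ∣ ∣ I ∣ (pow₂ k) (∣agreeing∣*2^∣I∣≤pow₂ k I w ys (λ a → AgreeOn-tail ∘ agree-ys a))

removed : ∀ {n} (L : List (Fin n)) → Vec Bool (length L) → Subset n
removed [] [] = ⊥
removed (l ∷ L) (true ∷ u) = removed L u
removed (l ∷ L) (false ∷ u) = ⁅ l ⁆ ∪ removed L u

removed⊆ : ∀ {n} (L : List (Fin n)) (u : Vec Bool (length L)) {v} → v ∈ removed L u → v ∈ₗ L
removed⊆ [] [] v∈ = contradiction v∈ ∉⊥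
removed⊆ (l ∷ L) (true ∷ u) v∈ = there (removed⊆ L u v∈)
removed⊆ (l ∷ L) (false ∷ u) v∈ with x∈p∪q⁻ ⁅ l ⁆ (removed L u) v∈
... | inj₁ v∈⁅l⁆ = here (x∈⁅y⁆⇒x≡y l v∈⁅l⁆)
... | inj₂ v∈removed = there (removed⊆ L u v∈removed)

lookup-∈-removed : ∀ {n} (L : List (Fin n)) u i → lookup u i ≡ false → List.lookup L i ∈ removed L u
lookup-∈-removed (l ∷ L) (false ∷ u) zero refl = x∈p∪q⁺ (inj₁ (x∈⁅x⁆ l))
lookup-∈-removed (l ∷ L) (true ∷ u) (suc i) uᵢ≡false = lookup-∈-removed L u i uᵢ≡false
lookup-∈-removed (l ∷ L) (false ∷ u) (suc i) uᵢ≡false = x∈p∪q⁺ (inj₂ (lookup-∈-removed L u i uᵢ≡false))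

lookup-∉-removed : ∀ {n} {L : List (Fin n)} → Unique L → ∀ u i → lookup u i ≡ true → List.lookup L i ∉ removed L u
lookup-∉-removed {L = l ∷ L} (l∉L ∷ _) (true ∷ u) zero refl l∈ = All.lookup l∉L (removed⊆ L u l∈) refl
lookup-∉-removed {L = l ∷ L} (_ ∷ unique) (true ∷ u) (suc i) uᵢ≡true =
  lookup-∉-removed unique u i uᵢ≡true
lookup-∉-removed {L = l ∷ L} (l∉L ∷ unique) (false ∷ u) (suc i) uᵢ≡true Lᵢ∈
  with x∈p∪q⁻ ⁅ l ⁆ (removed L u) Lᵢ∈
... | inj₁ Lᵢ∈⁅l⁆ = All.lookup l∉L (∈-lookup i) (sym (x∈⁅y⁆⇒x≡y l Lᵢ∈⁅l⁆))
... | inj₂ Lᵢ∈removed = lookup-∉-removed unique u i uᵢ≡true Lᵢ∈removed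

tradeoff : ∀ K m₁ m₂ h₁ h₂ → 2 ≤ K → K ≤ 2 * m₁ → h₂ * 2 ^ h₁ ≤ m₂ →
           (2 ^ (K * h₁) ≤ K ^ (2 * m₁)) ⊎ (2 ^ (K * h₂) ≤ K ^ (2 * m₂))
tradeoff zero _ _ _ _ ()
tradeoff K@(suc _) m₁ m₂ h₁ h₂ 2≤K K≤2m₁ h₂2^h₁≤m₂ with 2 ^ h₁ ≤? K
... | yes 2^h₁≤K = inj₁ (begin
    2 ^ (K * h₁)    ≡⟨ cong (2 ^_) (*-comm K h₁) ⟩
    2 ^ (h₁ * K)    ≡⟨ ^-*-assoc 2 h₁ K ⟨
    (2 ^ h₁) ^ K    ≤⟨ ^-monoˡ-≤ K 2^h₁≤K ⟩
    K ^ K           ≤⟨ ^-monoʳ-≤ K K≤2m₁ ⟩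
    K ^ (2 * m₁)    ∎)
  where open ≤-Reasoning
... | no 2^h₁≰K = inj₂ (begin
    2 ^ (K * h₂)    ≤⟨ ^-monoʳ-≤ 2 Kh₂≤m₂ ⟩
    2 ^ m₂          ≤⟨ ^-monoˡ-≤ m₂ 2≤K ⟩
    K ^ m₂          ≤⟨ ^-monoʳ-≤ K (m≤m+n m₂ (m₂ + 0)) ⟩
    K ^ (2 * m₂)    ∎)
  where
    open ≤-Reasoning
    Kh₂≤m₂ : K * h₂ ≤ m₂
    Kh₂≤m₂ = ≤-trans (subst (_≤ h₂ * 2 ^ h₁) (*-comm h₂ K) (*-monoʳ-≤ h₂ (<⇒≤ (≰⇒> 2^h₁≰K)))) h₂2^h₁≤m₂

Homogeneous : ∀ {n} {T : Graph n} {m₁ m₂} → Family T m₁ → Family T m₂ → Subset m₁ → Subset m₂ → Set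
Homogeneous F₁ F₂ H₁ H₂ =
  (∀ a b → a ∈ H₁ → b ∈ H₂ → Intersect (proj₁ (F₁ a)) (proj₁ (F₂ b)))
  ⊎ (∀ a b → a ∈ H₁ → b ∈ H₂ → Disjoint (proj₁ (F₁ a)) (proj₁ (F₂ b)))

NoLargeHomogeneousPair : ∀ {n} → Graph n → ℕ → Set
NoLargeHomogeneousPair T k = Σ ℕ λ m₁ → Σ ℕ λ m₂ → 1 ≤ m₁ × 1 ≤ m₂ ×
  Σ (Family T m₁) λ F₁ → Σ (Family T m₂) λ F₂ →
  (H₁ : Subset m₁) (H₂ : Subset m₂) → Homogeneous F₁ F₂ H₁ H₂ →
  (2 ^ (k * ∣ H₁ ∣) ≤ k ^ (2 * m₁)) ⊎ (2 ^ (k * ∣ H₂ ∣) ≤ k ^ (2 * m₂))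

module _ {n} (T : Graph n) (connected : Connected T) (x : Fin n) (L : List (Fin n))
         (unique : Unique L) (x∉L : x ∉ₗ L) (leaves : ∀ v → v ∈ₗ L → degree T v ≡ 1) where

  leafSingletons : Family T (length L)
  leafSingletons i = singletonSubtree T (List.lookup L i)

  pruned : Family T (pow₂ (length L))
  pruned a = ∁ (removed L (word _ a)) ,
    connectedOn-leaf-complement T _ (λ v v∉ → leaves v (removed⊆ L _ (x∉∁p⇒x∈p v∉))) connected
      (x∉p⇒x∈∁p (x∉L ∘ removed⊆ L _))

  homogeneous⇒agreeOn : ∀ H₁ H₂ → Homogeneous leafSingletons pruned H₁ H₂ →
    Σ Bool λ c → ∀ a → a ∈ H₂ → AgreeOn H₁ (word _ a) (replicate (length L) c)
  homogeneous⇒agreeOn H₁ H₂ (inj₁ intersect) = true , λ a a∈ i i∈ →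
    trans (kept (intersect i a i∈ a∈)) (sym (lookup-replicate i true))
    where
      kept : ∀ {i a} → Intersect ⁅ List.lookup L i ⁆ (proj₁ (pruned a)) → lookup (word _ a) i ≡ true
      kept {i} {a} (v , v∈⁅Lᵢ⁆ , v∈pruned) = ¬-not λ uᵢ≡false →
        x∈∁p⇒x∉p (subst (_∈ proj₁ (pruned a)) (x∈⁅y⁆⇒x≡y _ v∈⁅Lᵢ⁆) v∈pruned) (lookup-∈-removed L _ i uᵢ≡false)
  homogeneous⇒agreeOn H₁ H₂ (inj₂ disjoint) = false , λ a a∈ i i∈ →
    trans (deleted (disjoint i a i∈ a∈)) (sym (lookup-replicate i false))
    where
      deleted : ∀ {i a} → Disjoint ⁅ List.lookup L i ⁆ (proj₁ (pruned a)) → lookup (word _ a) i ≡ false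
      deleted {i} {a} Lᵢ∉pruned = ¬-not λ uᵢ≡true →
        Lᵢ∉pruned (_ , x∈⁅x⁆ _ , x∉p⇒x∈∁p (lookup-∉-removed unique _ i uᵢ≡true))

  leafFamilies-noLargeHomogeneousPair : 1 ≤ length L → NoLargeHomogeneousPair T (suc (length L))
  leafFamilies-noLargeHomogeneousPair 1≤k =
    length L , pow₂ (length L) , 1≤k , 1≤pow₂ (length L) , leafSingletons , pruned , λ H₁ H₂ homogeneous →
      let c , agree = homogeneous⇒agreeOn H₁ H₂ homogeneous in
      tradeoff (suc (length L)) (length L) (pow₂ (length L)) ∣ H₁ ∣ ∣ H₂ ∣ (s≤s 1≤k)
        (+-mono-≤ 1≤k (m≤m+n (length L) 0))
        (∣agreeing∣*2^∣I∣≤pow₂ (length L) H₁ (replicate (length L) c) H₂ agree)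

connected-noLargeHomogeneousPair : ∀ {n} {T : Graph n} → Connected T → (L : List (Fin n)) → Unique L →
  (∀ v → v ∈ₗ L → degree T v ≡ 1) → 2 ≤ length L → NoLargeHomogeneousPair T (length L)
connected-noLargeHomogeneousPair {T = T} connected (x ∷ L) (x∉L ∷ unique) leaves (s≤s 1≤k) =
  leafFamilies-noLargeHomogeneousPair T connected x L unique (All¬⇒¬Any x∉L) (λ v → leaves v ∘ there) 1≤k

leafList : ∀ {n} (T : Graph n) → Σ (List (Fin n)) λ L →
           Unique L × (∀ v → v ∈ₗ L → degree T v ≡ 1) × length L ≡ numLeaves T
leafList {n} T = List.filter isLeaf? (allFin n) , filter⁺ isLeaf? (allFin⁺ n) ,
  (λ v v∈ → proj₂ (∈-filter⁻ isLeaf? {xs = allFin n} v∈)) , refl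
  where
    isLeaf? = λ v → degree T v ≟ 1

theorem5p1 : (k : ℕ) → 17 ≤ k → (n : ℕ) → (T : Graph n) → IsTree T → numLeaves T ≡ k →
    Σ ℕ λ m₁ → Σ ℕ λ m₂ → 1 ≤ m₁ × 1 ≤ m₂ ×
    Σ (Family T m₁) λ F₁ → Σ (Family T m₂) λ F₂ →
      (H₁ : Subset m₁) → (H₂ : Subset m₂) →
      ((∀ a b → a ∈ H₁ → b ∈ H₂ → Intersect (proj₁ (F₁ a)) (proj₁ (F₂ b)))
        ⊎ (∀ a b → a ∈ H₁ → b ∈ H₂ → Disjoint (proj₁ (F₁ a)) (proj₁ (F₂ b)))) →
      (2 ^ (k * ∣ H₁ ∣) ≤ k ^ (2 * m₁)) ⊎ (2 ^ (k * ∣ H₂ ∣) ≤ k ^ (2 * m₂))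
theorem5p1 k 17≤k n T (connected , _) #leaves≡k =
  let L , unique , leaves , #L≡#leaves = leafList T
      #L≡k = trans #L≡#leaves #leaves≡k
  in subst (NoLargeHomogeneousPair T) #L≡k
       (connected-noLargeHomogeneousPair connected L unique leaves
         (subst (2 ≤_) (sym #L≡k) (≤-trans (s≤s (s≤s z≤n)) 17≤k)))
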